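{- Let $\Sigma=\{(,)\}$. There is no sentence $\sigma$ of $\mathsf{FOC}[+;\mathsf{MOD}]$ over $\Sigma$ such that for every nonempty $w\in\Sigma^*$, $w\vDash\sigma$ if and only if $w\in\text{Dyck-1}$.
   Context: Dyck-1 is the set of strings over $\{(,)\}$ of balanced parentheses: the total numbers of $($ and $)$ are equal and every prefix contains at least as many $($ as $)$. $\mathsf{FOC}[+;\mathsf{MOD}]$ (first-order logic with counting and modular predicates), evaluated on a string $w=w_1\cdots w_n$, $n\ge1$: two sorts of variables, position variables ranging over $[1,n]$ and count variables ranging over $[0,n]$. Count terms: count variables, nonnegative integer constants, and $t_1+t_2$. Formulas: $\top$, $Q_a(p)$ (true iff $w_p=a$), $\mathsf{MOD}^k_m(p)$ (true iff $p\equiv k\pmod m$), comparisons $t_1\le t_2$ (and $=,<$) of count terms, $\lnot\varphi$, $\varphi_1\land\varphi_2$, $\exists x.\varphi$ over count values, and $\exists^{=x}p.\varphi$ (true iff exactly $x$ positions $p$ satisfy $\varphi$). There are no relations comparing positions. A sentence has no free variables. -}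

module Defs where

open import Data.Nat using (ℕ; zero; suc; _+_; _≤_; _<_; _≡ᵇ_; _<ᵇ_; _%_)
open import Data.Bool using (Bool; true; false; not; _∧_; _∨_; if_then_else_)
open import Data.Fin using (Fin; zero; suc)
open import Data.List using (List; []; _∷_; length; take; upTo; map; foldr)
open import Data.Bool.ListAction using (any)
open import Data.Maybe using (Maybe; just; nothing)
open import Data.Product using (_×_)
open import Relation.Binary.PropositionalEquality using (_≡_)

data Sym : Set where
  ⟮ : Sym
  ⟯ : Sym

_≟ᵇ_ : Sym → Sym → Bool
⟮ ≟ᵇ ⟮ = true
⟯ ≟ᵇ ⟯ = true
_ ≟ᵇ _ = false

occ : Sym → List Sym → ℕ
occ a []      = 0
occ a (b ∷ w) = (if a ≟ᵇ b then 1 else 0) + occ a w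

Dyck1 : List Sym → Set
Dyck1 w = (occ ⟮ w ≡ occ ⟯ w) × (∀ k → occ ⟯ (take k w) ≤ occ ⟮ (take k w))

-- Syntax of FOC[+;MOD], with de Bruijn-indexed variables:
-- c = number of count variables in scope, p = number of position variables in scope.

data CTerm (c : ℕ) : Set where
  var   : Fin c → CTerm c
  const : ℕ → CTerm c
  _⊕_   : CTerm c → CTerm c → CTerm c

data Formula (c p : ℕ) : Set where
  ⊤ᶠ    : Formula c p
  Q     : Sym → Fin p → Formula c p
  MOD   : (k m : ℕ) → Fin p → Formula c p
  _≤ᶠ_  : CTerm c → CTerm c → Formula c p
  _≐ᶠ_  : CTerm c → CTerm c → Formula c p
  _<ᶠ_  : CTerm c → CTerm c → Formula c p
  ¬ᶠ_   : Formula c p → Formula c p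
  _∧ᶠ_  : Formula c p → Formula c p → Formula c p
  ∃ᶜ    : Formula (suc c) p → Formula c p
  ∃⁼    : Fin c → Formula c (suc p) → Formula c p  -- ∃^{=x} p. φ  (p a new position variable, index zero)

Sentence : Set
Sentence = Formula 0 0

-- Semantics on a word w = w_1 ⋯ w_n (positions 1..n, counts 0..n)

-- 1-indexed letter lookup
letterAt : List Sym → ℕ → Maybe Sym
letterAt []      _             = nothing
letterAt (a ∷ w) zero          = nothing
letterAt (a ∷ w) (suc zero)    = just a
letterAt (a ∷ w) (suc (suc i)) = letterAt w (suc i)

isLetter : Maybe Sym → Sym → Bool
isLetter (just b) a = a ≟ᵇ b
isLetter nothing  a = false

-- p ≡ k (mod m); for m = 0 this is p = k
modEq : ℕ → ℕ → ℕ → Bool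
modEq p k zero    = p ≡ᵇ k
modEq p k (suc m) = (p % suc m) ≡ᵇ (k % suc m)

extend : {c : ℕ} → (Fin c → ℕ) → ℕ → Fin (suc c) → ℕ
extend ρ v zero    = v
extend ρ v (suc i) = ρ i

⟦_⟧ᵗ : {c : ℕ} → CTerm c → (Fin c → ℕ) → ℕ
⟦ var i ⟧ᵗ ρ   = ρ i
⟦ const k ⟧ᵗ ρ = k
⟦ s ⊕ t ⟧ᵗ ρ   = ⟦ s ⟧ᵗ ρ + ⟦ t ⟧ᵗ ρ

countTrue : List Bool → ℕ
countTrue = foldr (λ b n → (if b then 1 else 0) + n) 0

countRange : List Sym → List ℕ
countRange w = upTo (suc (length w))

posRange : List Sym → List ℕ
posRange w = map suc (upTo (length w))

eval : {c p : ℕ} → (w : List Sym) → Formula c p → (Fin c → ℕ) → (Fin p → ℕ) → Bool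
eval w ⊤ᶠ         ρ π = true
eval w (Q a i)    ρ π = isLetter (letterAt w (π i)) a
eval w (MOD k m i) ρ π = modEq (π i) k m
eval w (s ≤ᶠ t)   ρ π = (⟦ s ⟧ᵗ ρ <ᵇ suc (⟦ t ⟧ᵗ ρ))
eval w (s ≐ᶠ t)   ρ π = ⟦ s ⟧ᵗ ρ ≡ᵇ ⟦ t ⟧ᵗ ρ
eval w (s <ᶠ t)   ρ π = ⟦ s ⟧ᵗ ρ <ᵇ ⟦ t ⟧ᵗ ρ
eval w (¬ᶠ φ)     ρ π = not (eval w φ ρ π)
eval w (φ ∧ᶠ ψ)   ρ π = eval w φ ρ π ∧ eval w ψ ρ π
eval w (∃ᶜ φ)     ρ π = any (λ v → eval w φ (extend ρ v) π) (countRange w)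
eval w (∃⁼ x φ)   ρ π =
  countTrue (map (λ q → eval w φ ρ (extend π q)) (posRange w)) ≡ᵇ ρ x

noVars : Fin 0 → ℕ
noVars ()

_⊨_ : List Sym → Sentence → Set
w ⊨ σ = eval w σ noVars noVars ≡ true

{-# OPTIONS --safe #-}
module Submission where

-- A sentence σ cannot distinguish two words that differ by exchanging the letters at positions
-- a < b, provided a and b satisfy the same MOD atoms of σ: the transposition (a b) maps the
-- positions of one word bijectively onto those of the other, preserving letters and MOD atoms,
-- so no count ∃^{=x} changes. If N bounds the constants and moduli occurring in σ, then
-- a = 2N + 1 and b = a + N! qualify, and exchanging them turns the Dyck word (()^N (^{N!} )^{N!}
-- into a word whose prefix of length 2N + 1 has more ) than (.

open import Defs
open import Data.List using (List; [])
open import Data.Product using (Σ; _×_)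
open import Relation.Nullary using (¬_)
open import Relation.Binary.PropositionalEquality using (_≡_)

open import Data.Bool using (Bool; true; false; not; _∧_; if_then_else_)
open import Data.Bool.ListAction using (any; or)
open import Data.Bool.Properties using (T-≡)
open import Data.Empty using (⊥-elim)
open import Data.Fin using (zero; suc)
open import Data.Maybe using (nothing; just)
open import Data.List using (_∷_; _++_; length; map; take; replicate; upTo; applyUpTo)
open import Data.List.Properties
  using (map-cong; map-∘; map-++; map-id-local; length-++; length-map; length-upTo; length-replicate; map-upTo; ++-conicalʳ)
open import Data.List.Relation.Unary.All as All using (All; []; _∷_)
open import Data.List.Relation.Unary.All.Properties using (++⁻; applyUpTo⁺₁)
import Data.List.Relation.Binary.Permutation.Propositional as ↭
open ↭ using (_↭_; ↭-sym; module PermutationReasoning)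
open import Data.List.Relation.Binary.Permutation.Propositional.Properties using (map⁺; ++⁺ˡ; shift; ↭-length)
open import Data.Nat using (ℕ; zero; suc; pred; _+_; _≤_; _<_; _≡ᵇ_; _%_; _!; z≤n; s≤s; z<s; s<s)
open import Data.Nat.Divisibility using (_∣_; divides; ∣-trans; m∣m*n; m≤n⇒m!∣n!; ∣-refl)
open import Data.Nat.DivMod using ([m+kn]%n≡m%n)
open import Data.Nat.ListAction using (sum)
open import Data.Nat.Properties
  using ( ≡ᵇ⇒≡; ≡⇒≡ᵇ; <⇒≢; >⇒≢; <⇒≱; <-trans; <-≤-trans; ≤-trans; m≤m+n; m≤n+m; m<m+n; +-monoʳ-<
        ; n≤1+n; +-suc; +-identityʳ; suc-pred; _!≢0; +-commutativeSemigroup)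
open import Data.Product using (_,_; proj₁; proj₂; uncurry)
open import Function using (_∘_)
open import Function.Bundles using (Equivalence)
open import Relation.Binary.PropositionalEquality using (_≢_; refl; sym; trans; cong; cong₂; subst; module ≡-Reasoning)
open import Algebra.Properties.CommutativeSemigroup +-commutativeSemigroup using (x∙yz≈y∙xz)

≡ᵇ-true⇒≡ : ∀ {m n} → (m ≡ᵇ n) ≡ true → m ≡ n
≡ᵇ-true⇒≡ {m} {n} eq = ≡ᵇ⇒≡ m n (Equivalence.from T-≡ eq)

≡ᵇ-refl : ∀ m → (m ≡ᵇ m) ≡ true
≡ᵇ-refl m = Equivalence.to T-≡ (≡⇒≡ᵇ m m refl)

≢⇒≡ᵇ-false : ∀ {m n} → m ≢ n → (m ≡ᵇ n) ≡ false
≢⇒≡ᵇ-false {m} {n} m≢n with m ≡ᵇ n in eq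
... | true  = ⊥-elim (m≢n (≡ᵇ-true⇒≡ eq))
... | false = refl

≡ᵇ-false⇒≢ : ∀ {m n} → (m ≡ᵇ n) ≡ false → m ≢ n
≡ᵇ-false⇒≢ {m} m≟n refl with () ← trans (sym m≟n) (≡ᵇ-refl m)

transpose : ℕ → ℕ → ℕ → ℕ
transpose a b p = if p ≡ᵇ a then b else if p ≡ᵇ b then a else p

transpose-suc : ∀ a b p → transpose (suc a) (suc b) (suc p) ≡ suc (transpose a b p)
transpose-suc a b p with p ≡ᵇ a
... | true = refl
... | false with p ≡ᵇ b
...   | true  = refl
...   | false = refl

transpose-left : ∀ a b → transpose a b a ≡ b
transpose-left a b rewrite ≡ᵇ-refl a = refl

transpose-right : ∀ {a b} → a ≢ b → transpose a b b ≡ a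
transpose-right {a} {b} a≢b rewrite ≢⇒≡ᵇ-false (a≢b ∘ sym) | ≡ᵇ-refl b = refl

transpose-fixes : ∀ {a b p} → p ≢ a → p ≢ b → transpose a b p ≡ p
transpose-fixes p≢a p≢b rewrite ≢⇒≡ᵇ-false p≢a | ≢⇒≡ᵇ-false p≢b = refl

transpose-invariant : ∀ {B : Set} (f : ℕ → B) {a b} → f a ≡ f b → ∀ p → f (transpose a b p) ≡ f p
transpose-invariant f {a} {b} fa≡fb p with p ≡ᵇ a in p≟a
... | true = trans (sym fa≡fb) (cong f (sym (≡ᵇ-true⇒≡ p≟a)))
... | false with p ≡ᵇ b in p≟b
...   | true  = trans fa≡fb (cong f (sym (≡ᵇ-true⇒≡ p≟b)))
...   | false = refl

bit : Bool → ℕ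
bit b = if b then 1 else 0

countTrue-↭ : ∀ {bs cs} → bs ↭ cs → countTrue bs ≡ countTrue cs
countTrue-↭ ↭.refl         = refl
countTrue-↭ (↭.prep b p)   = cong (bit b +_) (countTrue-↭ p)
countTrue-↭ (↭.swap b c p) = trans (cong (λ n → bit b + (bit c + n)) (countTrue-↭ p)) (x∙yz≈y∙xz (bit b) (bit c) _)
countTrue-↭ (↭.trans p q)  = trans (countTrue-↭ p) (countTrue-↭ q)

modAtoms : ∀ {c p} → Formula c p → List (ℕ × ℕ)
modAtoms (MOD k m _) = (k , m) ∷ []
modAtoms (¬ᶠ φ)      = modAtoms φ
modAtoms (φ ∧ᶠ ψ)    = modAtoms φ ++ modAtoms ψ
modAtoms (∃ᶜ φ)      = modAtoms φ
modAtoms (∃⁼ _ φ)    = modAtoms φ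
modAtoms _           = []

ModPreserving : (ℕ → ℕ) → ℕ × ℕ → Set
ModPreserving s (k , m) = ∀ p → modEq (s p) k m ≡ modEq p k m

length-posRange : ∀ w → length (posRange w) ≡ length w
length-posRange w = trans (length-map suc (upTo (length w))) (length-upTo (length w))

module Relabelling (u v : List Sym) (s : ℕ → ℕ)
  (positions : map s (posRange u) ↭ posRange v)
  (letters : ∀ p → letterAt v (s p) ≡ letterAt u p)
  where

  countRange-≡ : countRange u ≡ countRange v
  countRange-≡ = cong (upTo ∘ suc) (begin
    length u                    ≡⟨ length-posRange u ⟨
    length (posRange u)         ≡⟨ length-map s (posRange u) ⟨
    length (map s (posRange u)) ≡⟨ ↭-length positions ⟩
    length (posRange v)         ≡⟨ length-posRange v ⟩
    length v                    ∎)
    where open ≡-Reasoning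

  countTrue-relabel : ∀ (g : ℕ → Bool) → countTrue (map (g ∘ s) (posRange u)) ≡ countTrue (map g (posRange v))
  countTrue-relabel g = trans (cong countTrue (map-∘ (posRange u))) (countTrue-↭ (map⁺ g positions))

  eval-relabel : ∀ {c p} (φ : Formula c p) ρ π π' → (∀ i → s (π i) ≡ π' i) →
    All (ModPreserving s) (modAtoms φ) → eval u φ ρ π ≡ eval v φ ρ π'
  eval-relabel ⊤ᶠ          _ _ _  _      _         = refl
  eval-relabel (Q a i)     _ π _  sπ≗π' _         =
    cong (λ l → isLetter l a) (trans (sym (letters (π i))) (cong (letterAt v) (sπ≗π' i)))
  eval-relabel (MOD k m i) _ π _  sπ≗π' (s✓ ∷ []) = trans (sym (s✓ (π i))) (cong (λ q → modEq q k m) (sπ≗π' i))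
  eval-relabel (_ ≤ᶠ _)    _ _ _  _      _         = refl
  eval-relabel (_ ≐ᶠ _)    _ _ _  _      _         = refl
  eval-relabel (_ <ᶠ _)    _ _ _  _      _         = refl
  eval-relabel (¬ᶠ φ)      ρ π π' sπ≗π' s✓        = cong not (eval-relabel φ ρ π π' sπ≗π' s✓)
  eval-relabel (φ ∧ᶠ ψ)    ρ π π' sπ≗π' s✓        =
    let s✓φ , s✓ψ = ++⁻ (modAtoms φ) s✓
    in cong₂ _∧_ (eval-relabel φ ρ π π' sπ≗π' s✓φ) (eval-relabel ψ ρ π π' sπ≗π' s✓ψ)
  eval-relabel (∃ᶜ φ)      ρ π π' sπ≗π' s✓        =
    trans (cong or (map-cong (λ n → eval-relabel φ (extend ρ n) π π' sπ≗π' s✓) (countRange u)))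
          (cong (any (λ n → eval v φ (extend ρ n) π')) countRange-≡)
  eval-relabel (∃⁼ x φ)    ρ π π' sπ≗π' s✓        = cong (_≡ᵇ ρ x) (trans
    (cong countTrue (map-cong (λ q → eval-relabel φ ρ (extend π q) (extend π' (s q)) (sπ≗π'-extend q) s✓) (posRange u)))
    (countTrue-relabel (λ q → eval v φ ρ (extend π' q))))
    where
    sπ≗π'-extend : ∀ q i → s (extend π q i) ≡ extend π' (s q) i
    sπ≗π'-extend q zero    = refl
    sπ≗π'-extend q (suc i) = sπ≗π' i

  ⊨-relabel : (σ : Sentence) → All (ModPreserving s) (modAtoms σ) → u ⊨ σ → v ⊨ σ
  ⊨-relabel σ s✓ = trans (sym (eval-relabel σ noVars noVars noVars (λ ()) s✓))

modEq-+-multiple : ∀ {a d k m n} → k < a → m ≤ n → n ! ∣ d → modEq (a + d) k m ≡ modEq a k m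
modEq-+-multiple {a} {d} {m = zero} k<a _ _ =
  trans (≢⇒≡ᵇ-false (>⇒≢ (<-≤-trans k<a (m≤m+n a d)))) (sym (≢⇒≡ᵇ-false (>⇒≢ k<a)))
modEq-+-multiple {a} {d} {k} {suc m} _ m<n n!∣d
  with divides q d≡q*m ← ∣-trans (∣-trans (m∣m*n (m !)) (m≤n⇒m!∣n! m<n)) n!∣d =
  cong (_≡ᵇ k % suc m) (trans (cong (λ t → (a + t) % suc m) d≡q*m) ([m+kn]%n≡m%n a q (suc m)))

All-≤-sum : ∀ {A : Set} (f : A → ℕ) xs → All (λ x → f x ≤ sum (map f xs)) xs
All-≤-sum f []       = []
All-≤-sum f (x ∷ xs) = m≤m+n (f x) _ ∷ All.map (λ fy≤ → ≤-trans fy≤ (m≤n+m _ (f x))) (All-≤-sum f xs)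

modBound : ∀ {c p} → Formula c p → ℕ
modBound φ = sum (map (uncurry _+_) (modAtoms φ))

transpose-preserves-modAtoms : ∀ {c p} (φ : Formula c p) {a d} → modBound φ < a → modBound φ ! ∣ d →
  All (ModPreserving (transpose a (a + d))) (modAtoms φ)
transpose-preserves-modAtoms φ {a} {d} N<a N!∣d = All.map (λ {km} → preserves km) (All-≤-sum (uncurry _+_) (modAtoms φ))
  where
  preserves : ∀ km → uncurry _+_ km ≤ modBound φ → ModPreserving (transpose a (a + d)) km
  preserves (k , m) k+m≤N = transpose-invariant (λ p → modEq p k m)
    (sym (modEq-+-multiple (<-≤-trans (s≤s (≤-trans (m≤m+n k m) k+m≤N)) N<a) (≤-trans (m≤n+m m k) k+m≤N) N!∣d))

exchange-↭ : ∀ {A : Set} (xs ys zs : List A) x y → xs ++ y ∷ ys ++ x ∷ zs ↭ xs ++ x ∷ ys ++ y ∷ zs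
exchange-↭ xs ys zs x y = ++⁺ˡ xs (begin
  y ∷ ys ++ x ∷ zs  ↭⟨ ↭.prep y (shift x ys zs) ⟩
  y ∷ x ∷ ys ++ zs  ↭⟨ ↭.swap y x ↭.refl ⟩
  x ∷ y ∷ ys ++ zs  ↭⟨ ↭.prep x (↭-sym (shift y ys zs)) ⟩
  x ∷ ys ++ y ∷ zs  ∎)
  where open PermutationReasoning

map-transpose-↭ : ∀ {a b} xs ys zs → a < b →
  All (_< a) xs → All (λ p → a < p × p < b) ys → All (b <_) zs →
  map (transpose a b) (xs ++ a ∷ ys ++ b ∷ zs) ↭ xs ++ a ∷ ys ++ b ∷ zs
map-transpose-↭ {a} {b} xs ys zs a<b xs<a a<ys<b b<zs =
  subst (_↭ xs ++ a ∷ ys ++ b ∷ zs) (sym mapped) (exchange-↭ xs ys zs a b)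
  where
  τ : ℕ → ℕ
  τ = transpose a b
  mapped : map τ (xs ++ a ∷ ys ++ b ∷ zs) ≡ xs ++ b ∷ ys ++ a ∷ zs
  mapped = begin
    map τ (xs ++ a ∷ ys ++ b ∷ zs)                ≡⟨ map-++ τ xs _ ⟩
    map τ xs ++ τ a ∷ map τ (ys ++ b ∷ zs)        ≡⟨ cong (λ t → map τ xs ++ τ a ∷ t) (map-++ τ ys _) ⟩
    map τ xs ++ τ a ∷ map τ ys ++ τ b ∷ map τ zs
      ≡⟨ cong₂ _++_ (map-id-local (All.map (λ p<a → transpose-fixes (<⇒≢ p<a) (<⇒≢ (<-trans p<a a<b))) xs<a))
           (cong₂ _∷_ (transpose-left a b)
             (cong₂ _++_ (map-id-local (All.map (λ (a<p , p<b) → transpose-fixes (>⇒≢ a<p) (<⇒≢ p<b)) a<ys<b))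
               (cong₂ _∷_ (transpose-right (<⇒≢ a<b))
                 (map-id-local (All.map (λ b<p → transpose-fixes (>⇒≢ (<-trans a<b b<p)) (>⇒≢ b<p)) b<zs))))) ⟩
    xs ++ b ∷ ys ++ a ∷ zs                        ∎
    where open ≡-Reasoning

applyUpTo-+-suc : ∀ {A : Set} (f : ℕ → A) m n →
  applyUpTo f (m + suc n) ≡ applyUpTo f m ++ f m ∷ applyUpTo (λ j → f (m + suc j)) n
applyUpTo-+-suc f zero    n = refl
applyUpTo-+-suc f (suc m) n = cong (f 0 ∷_) (applyUpTo-+-suc (f ∘ suc) m n)

length-exchange : ∀ X Y Z (c d : Sym) →
  length (X ++ c ∷ Y ++ d ∷ Z) ≡ length X + suc (length Y + suc (length Z))
length-exchange X Y Z c d = trans (length-++ X) (cong (λ n → length X + suc n) (length-++ Y))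

module _ (x y z : ℕ) where

  private
    a b : ℕ
    a = suc x
    b = a + suc y

    layout : List ℕ
    layout = applyUpTo suc x ++ a ∷ applyUpTo (λ j → a + suc j) y ++ b ∷ applyUpTo (λ j → a + suc (y + suc j)) z

    posRange-layout : ∀ w → length w ≡ x + suc (y + suc z) → posRange w ≡ layout
    posRange-layout w ∣w∣ = begin
      map suc (upTo (length w))                               ≡⟨ cong (map suc ∘ upTo) ∣w∣ ⟩
      map suc (upTo (x + suc (y + suc z)))                    ≡⟨ map-upTo suc _ ⟩
      applyUpTo suc (x + suc (y + suc z))                     ≡⟨ applyUpTo-+-suc suc x _ ⟩
      applyUpTo suc x ++ a ∷ applyUpTo (λ j → a + suc j) (y + suc z)
        ≡⟨ cong (λ t → applyUpTo suc x ++ a ∷ t) (applyUpTo-+-suc (λ j → a + suc j) y z) ⟩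
      layout                                                  ∎
      where open ≡-Reasoning

  transpose-posRange-↭ : ∀ u v → length u ≡ x + suc (y + suc z) → length v ≡ x + suc (y + suc z) →
    map (transpose (suc x) (suc x + suc y)) (posRange u) ↭ posRange v
  transpose-posRange-↭ u v ∣u∣ ∣v∣ rewrite posRange-layout u ∣u∣ | posRange-layout v ∣v∣ =
    map-transpose-↭ _ _ _ (s<s (m<m+n x z<s))
      (applyUpTo⁺₁ suc x s<s)
      (applyUpTo⁺₁ _ y (λ j<y → s<s (m<m+n x z<s) , s<s (+-monoʳ-< x (s<s j<y))))
      (applyUpTo⁺₁ _ z (λ _ → s<s (+-monoʳ-< x (s<s (m<m+n y z<s)))))

letterAt-zero : ∀ w → letterAt w 0 ≡ nothing
letterAt-zero []      = refl
letterAt-zero (_ ∷ _) = refl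

letterAt-mid : ∀ Y Z c → letterAt (Y ++ c ∷ Z) (suc (length Y)) ≡ just c
letterAt-mid []      Z c = refl
letterAt-mid (_ ∷ Y) Z c = letterAt-mid Y Z c

letterAt-other : ∀ Y {Z c d} j → j ≢ length Y → letterAt (Y ++ c ∷ Z) (suc j) ≡ letterAt (Y ++ d ∷ Z) (suc j)
letterAt-other []      zero    j≢0 = ⊥-elim (j≢0 refl)
letterAt-other []      (suc j) _   = refl
letterAt-other (_ ∷ Y) zero    _   = refl
letterAt-other (_ ∷ Y) (suc j) j≢  = letterAt-other Y j (j≢ ∘ cong suc)

-- The transposition acts on 0-based indices here, so that consing onto X shifts both sides by one (transpose-suc).
letterAt-exchange : ∀ X Y Z c d i →
  letterAt (X ++ d ∷ Y ++ c ∷ Z) (suc (transpose (length X) (length X + suc (length Y)) i))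
    ≡ letterAt (X ++ c ∷ Y ++ d ∷ Z) (suc i)
letterAt-exchange []      Y Z c d zero = letterAt-mid Y Z c
letterAt-exchange []      Y Z c d (suc j) with j ≡ᵇ length Y in j≟∣Y∣
... | true  = sym (trans (cong (λ t → letterAt (Y ++ d ∷ Z) (suc t)) (≡ᵇ-true⇒≡ j≟∣Y∣)) (letterAt-mid Y Z d))
... | false = letterAt-other Y j (≡ᵇ-false⇒≢ j≟∣Y∣)
letterAt-exchange (_ ∷ X) Y Z c d zero = refl
letterAt-exchange (_ ∷ X) Y Z c d (suc j)
  rewrite transpose-suc (length X) (length X + suc (length Y)) j = letterAt-exchange X Y Z c d j

module Exchange (X Y Z : List Sym) (c d : Sym) where

  a b : ℕ
  a = suc (length X)
  b = a + suc (length Y)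

  u v : List Sym
  u = X ++ c ∷ Y ++ d ∷ Z
  v = X ++ d ∷ Y ++ c ∷ Z

  letters : ∀ p → letterAt v (transpose a b p) ≡ letterAt u p
  letters zero = trans (letterAt-zero v) (sym (letterAt-zero u))
  letters (suc i) rewrite transpose-suc (length X) (length X + suc (length Y)) i = letterAt-exchange X Y Z c d i

  positions : map (transpose a b) (posRange u) ↭ posRange v
  positions = transpose-posRange-↭ (length X) (length Y) (length Z) u v
    (length-exchange X Y Z c d) (length-exchange X Y Z d c)

  open Relabelling u v (transpose a b) positions letters public using (⊨-relabel)

-- Closes h w : the word (^h w is in Dyck-1.
data Closes : ℕ → List Sym → Set where
  []   : Closes 0 []
  up   : ∀ {h w} → Closes (suc h) w → Closes h (⟮ ∷ w)
  down : ∀ {h w} → Closes h w → Closes (suc h) (⟯ ∷ w)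

closes-occ : ∀ {h w} → Closes h w → occ ⟯ w ≡ h + occ ⟮ w
closes-occ []                 = refl
closes-occ {h} {⟮ ∷ w} (up c) = trans (closes-occ c) (sym (+-suc h (occ ⟮ w)))
closes-occ (down c)           = cong suc (closes-occ c)

closes-prefix : ∀ {h w} → Closes h w → ∀ k → occ ⟯ (take k w) ≤ h + occ ⟮ (take k w)
closes-prefix c        zero    = z≤n
closes-prefix []       (suc k) = z≤n
closes-prefix {h} {⟮ ∷ w} (up c) (suc k) =
  subst (occ ⟯ (take k w) ≤_) (sym (+-suc h (occ ⟮ (take k w)))) (closes-prefix c k)
closes-prefix (down c) (suc k) = s≤s (closes-prefix c k)

closes-Dyck1 : ∀ {w} → Closes 0 w → Dyck1 w
closes-Dyck1 c = sym (closes-occ c) , closes-prefix c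

pairs : ℕ → List Sym
pairs zero    = []
pairs (suc n) = ⟮ ∷ ⟯ ∷ pairs n

closes-pairs : ∀ n {h w} → Closes h w → Closes h (pairs n ++ w)
closes-pairs zero    c = c
closes-pairs (suc n) c = up (down (closes-pairs n c))

closes-⟯ⁿ : ∀ n → Closes n (replicate n ⟯)
closes-⟯ⁿ zero    = []
closes-⟯ⁿ (suc n) = down (closes-⟯ⁿ n)

closes-⟮ⁿ : ∀ n {h w} → Closes (n + h) w → Closes h (replicate n ⟮ ++ w)
closes-⟮ⁿ zero    c = c
closes-⟮ⁿ (suc n) {h} {w} c = up (closes-⟮ⁿ n (subst (λ t → Closes t w) (sym (+-suc n h)) c))

closes-⟮ⁿ⟯ⁿ : ∀ n → Closes 0 (replicate n ⟮ ++ replicate n ⟯)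
closes-⟮ⁿ⟯ⁿ n = closes-⟮ⁿ n (subst (λ t → Closes t (replicate n ⟯)) (sym (+-identityʳ n)) (closes-⟯ⁿ n))

pairs-⟯-unbalanced : ∀ n r →
  let prefix = take (suc (length (pairs n))) (pairs n ++ ⟯ ∷ r) in occ ⟮ prefix < occ ⟯ prefix
pairs-⟯-unbalanced zero    r = s≤s z≤n
pairs-⟯-unbalanced (suc n) r = s≤s (pairs-⟯-unbalanced n r)

¬Dyck1-pairs-⟯ : ∀ n r → ¬ Dyck1 (pairs n ++ ⟯ ∷ r)
¬Dyck1-pairs-⟯ n r (_ , prefixes) = <⇒≱ (pairs-⟯-unbalanced n r) (prefixes (suc (length (pairs n))))

n≤length-pairs : ∀ n → n ≤ length (pairs n)
n≤length-pairs zero    = z≤n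
n≤length-pairs (suc n) = s≤s (≤-trans (n≤length-pairs n) (n≤1+n _))

++-∷-≢-[] : ∀ {A : Set} (xs : List A) {y ys} → xs ++ y ∷ ys ≢ []
++-∷-≢-[] xs eq with () ← ++-conicalʳ xs _ eq

proposition1 : ¬ (Σ Sentence (λ σ → (w : List Sym) → ¬ (w ≡ []) → ((w ⊨ σ → Dyck1 w) × (Dyck1 w → w ⊨ σ))))
proposition1 (σ , defines) = ¬Dyck1-pairs-⟯ N (Y ++ ⟮ ∷ Z) (proj₁ (defines v (++-∷-≢-[] X)) v⊨σ)
  where
  N M : ℕ
  N = modBound σ
  M = pred (N !)

  X Y Z : List Sym
  X = pairs N
  Y = replicate M ⟮
  Z = replicate M ⟯
  open Exchange X Y Z ⟮ ⟯

  u⊨σ : u ⊨ σ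
  u⊨σ = proj₂ (defines u (++-∷-≢-[] X)) (closes-Dyck1 (closes-pairs N (closes-⟮ⁿ⟯ⁿ (suc M))))

  N!∣b-a : N ! ∣ suc (length Y)
  N!∣b-a = subst (N ! ∣_) (sym (trans (cong suc (length-replicate M)) (suc-pred (N !) {{N !≢0}}))) ∣-refl

  v⊨σ : v ⊨ σ
  v⊨σ = ⊨-relabel σ (transpose-preserves-modAtoms σ (s≤s (n≤length-pairs N)) N!∣b-a) u⊨σ
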